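{- Let $q$ be an odd prime power and let $\mathcal{C}=\varphi\times\chi$ be the combined coloring of the complete graph on $\mathbb{F}_q^2$ defined in the context. There do not exist distinct $a,b,c,d,e\in\mathbb{F}_q^2$ with $\mathcal{C}(ab)=\mathcal{C}(cd)$, $\mathcal{C}(bc)=\mathcal{C}(ad)=\mathcal{C}(be)=\mathcal{C}(de)$ and $\mathcal{C}(ac)=\mathcal{C}(ae)$.
   Context: Modified CFLS coloring: for a positive integer $\ell$ and $x,y\in\{0,1\}^{\ell^2}$ distinct, write $v=(v^{(1)},\dots,v^{(\ell)})$ in blocks $v^{(k)}\in\{0,1\}^\ell$; let $\varphi_1(x,y)=((i,\{x^{(i)},y^{(i)}\}),i_1,\dots,i_\ell)$ where $i$ is the least index with $x^{(i)}\ne y^{(i)}$ and $i_k=0$ if $x^{(k)}=y^{(k)}$, else $i_k$ is the least bit position where $x^{(k)},y^{(k)}$ differ. Strings are ordered as binary integers (first bit most significant); for $x<y$, $\varphi_2(x,y)=\varphi_2(y,x)=(\delta_1,\dots,\delta_\ell)$ with $\delta_k=-1$ if $x^{(k)}>y^{(k)}$, $+1$ if $x^{(k)}\le y^{(k)}$; $\varphi=(\varphi_1,\varphi_2)$. Embedding: fix a linear order on $\mathbb{F}_q$; for $\alpha\in\mathbb{F}_q$ let $\alpha'\in\{0,1\}^{\lceil\log_2 q\rceil}$ be the binary representation of the rank of $\alpha$. Let $\ell$ be the least positive integer with $2\lceil\log_2 q\rceil\le\ell^2$, and map $x=(x_1,x_2)\in\mathbb{F}_q^2$ to $\sigma(x)=(x_1',x_2',0,\dots,0)\in\{0,1\}^{\ell^2}$.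 Order $\mathbb{F}_q^2$ by $x<y$ iff $\sigma(x)<\sigma(y)$. Algebraic coloring: $\chi_1(xy)=(x_1y_1-x_2-y_2,\delta(x_1,y_1))$, $\delta=0$ if $x_1=y_1$, else $1$. For $\alpha\in\mathbb{F}_q$, the pairs $\{x,y\}\subseteq\mathbb{F}_q\setminus\{\alpha\}$ with $x+y=2\alpha$ form a perfect matching; fix a partition $\mathbb{F}_q\setminus\{\alpha\}=S_\alpha\cup T_\alpha$ separating each matched pair, and let $f_\alpha(\beta)=S$ or $T$ according as $\beta\in S_\alpha$ or $T_\alpha$. For $x<y$ with $x_1\ne y_1$, $\chi_2(xy)=(f_{x_1}(y_1),f_{y_1}(x_1))$; if $x_1=y_1$, $\chi_2(xy)$ is a fixed value. $\chi=(\chi_1,\chi_2)$. Combined: $\mathcal{C}(xy)=(\varphi(\sigma(x),\sigma(y)),\chi(xy))$. -}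

module Defs where

open import Level using (Level)
open import Data.Bool using (Bool; true; false; if_then_else_; _∧_; not)
open import Data.Nat using (ℕ; zero; suc; _+_; _*_; _∸_; _^_; _≤ᵇ_; _≡ᵇ_)
open import Data.Nat.Logarithm using (⌈log₂_⌉)
open import Data.Nat.Primality using (Prime)
open import Data.Fin using (Fin; toℕ)
open import Data.List using (List; []; _∷_; _++_; take; drop; replicate)
open import Data.Maybe using (Maybe; just; nothing)
open import Data.Product using (_×_; _,_; Σ; ∃)
open import Relation.Binary.PropositionalEquality using (_≡_)
open import Relation.Nullary using (¬_)
open import Function.Bundles using (_↔_; Inverse)
open import Algebra.Bundles using (CommutativeRing)

IsPrimePower : ℕ → Set
IsPrimePower q = Σ ℕ λ p → Σ ℕ λ k → Prime p × q ≡ p ^ suc k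

IsField : ∀ {c ℓ} → CommutativeRing c ℓ → Set (c Level.⊔ ℓ)
IsField R = ¬ (1# ≈ 0#) × (∀ x → ¬ (x ≈ 0#) → ∃ λ y → x *ᴿ y ≈ 1#)
  where open CommutativeRing R renaming (_*_ to _*ᴿ_; _+_ to _+ᴿ_)

-- Bit strings (lists of booleans, true = 1)

toBits : ℕ → ℕ → List Bool
toBits zero    n = []
toBits (suc m) n = if 2 ^ m ≤ᵇ n then true ∷ toBits m (n ∸ 2 ^ m)
                                 else false ∷ toBits m n

eqBits : List Bool → List Bool → Bool
eqBits []      []      = true
eqBits (a ∷ s) (b ∷ t) = (if a then b else not b) ∧ eqBits s t
eqBits _       _       = false

-- strict order of bit strings read as binary integers (equal lengths)
ltBits : List Bool → List Bool → Bool
ltBits (false ∷ s) (true  ∷ t) = true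
ltBits (true  ∷ s) (false ∷ t) = false
ltBits (_     ∷ s) (_     ∷ t) = ltBits s t
ltBits _           _           = false

shiftPos : ℕ → ℕ
shiftPos zero    = zero
shiftPos (suc j) = suc (suc j)

-- 0 if the strings are equal, otherwise the least (1-based) position
-- at which they differ
diffPos : List Bool → List Bool → ℕ
diffPos (a ∷ s) (b ∷ t) = if (if a then b else not b) then shiftPos (diffPos s t) else 1
diffPos _       _       = 0

chunks : ℕ → ℕ → List Bool → List (List Bool)
chunks l zero    s = []
chunks l (suc n) s = take l s ∷ chunks l n (drop l s)

-- least (1-based) index of a differing block, with the unordered pair of
-- the two differing blocks (stored as (smaller, larger)); the index
-- argument is the index of the current head block
firstBlock : ℕ → List (List Bool) → List (List Bool) → ℕ × (List Bool × List Bool)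
firstBlock i (u ∷ us) (v ∷ vs) =
  if eqBits u v then firstBlock (suc i) us vs
  else (i , (if ltBits u v then (u , v) else (v , u)))
firstBlock i _ _ = (0 , ([] , []))

data Sign : Set where
  minus plus : Sign

module CFLS (l : ℕ) where

  blocks : List Bool → List (List Bool)
  blocks = chunks l l

  φ₁ : List Bool → List Bool → (ℕ × (List Bool × List Bool)) × List ℕ
  φ₁ x y = firstBlock 1 (blocks x) (blocks y) , go (blocks x) (blocks y)
    where
    go : List (List Bool) → List (List Bool) → List ℕ
    go (u ∷ us) (v ∷ vs) = diffPos u v ∷ go us vs
    go _ _ = []

  signs : List (List Bool) → List (List Bool) → List Sign
  signs (u ∷ us) (v ∷ vs) = (if ltBits v u then minus else plus) ∷ signs us vs
  signs _ _ = []

  φ₂ : List Bool → List Bool → List Sign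
  φ₂ x y = if ltBits x y then signs (blocks x) (blocks y)
                         else signs (blocks y) (blocks x)

  φ : List Bool → List Bool →
      ((ℕ × (List Bool × List Bool)) × List ℕ) × List Sign
  φ x y = φ₁ x y , φ₂ x y

-- ℓ = least positive integer with 2m ≤ ℓ²

searchSq : ℕ → ℕ → ℕ → ℕ
searchSq t zero       k = k
searchSq t (suc fuel) k = if t ≤ᵇ k * k then k else searchSq t fuel (suc k)

leastSqAbove : ℕ → ℕ
leastSqAbove t = searchSq t t 1

-- The combined coloring on F_q², parametrised by the field R, the
-- linear order on F_q given by a bijection e : F_q ↔ Fin q (rank), and
-- the choice of partitions S_α ∪ T_α given by f α β (true = S, false = T).

module Combined {c ℓ'} (R : CommutativeRing c ℓ') (q : ℕ)
                (e : CommutativeRing.Carrier R ↔ Fin q)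
                (f : CommutativeRing.Carrier R → CommutativeRing.Carrier R → Bool) where

  open CommutativeRing R renaming (_*_ to _*ᴿ_; _+_ to _+ᴿ_)

  Point : Set c
  Point = Carrier × Carrier

  infixl 6 _−_
  _−_ : Carrier → Carrier → Carrier
  x − y = x +ᴿ (- y)

  rank : Carrier → ℕ
  rank α = toℕ (Inverse.to e α)

  m : ℕ
  m = ⌈log₂ q ⌉

  ℓ : ℕ
  ℓ = leastSqAbove (2 * m)

  bin : Carrier → List Bool
  bin α = toBits m (rank α)

  σ : Point → List Bool
  σ (x₁ , x₂) = bin x₁ ++ bin x₂ ++ replicate (ℓ * ℓ ∸ 2 * m) false

  lt : Point → Point → Bool
  lt x y = ltBits (σ x) (σ y)

  sameFirst : Point → Point → Bool
  sameFirst (x₁ , _) (y₁ , _) = rank x₁ ≡ᵇ rank y₁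

  -- δ(x₁,y₁) = 0 (false) if x₁ = y₁, else 1 (true)
  χ₁ : Point → Point → Carrier × Bool
  χ₁ (x₁ , x₂) (y₁ , y₂) = (x₁ *ᴿ y₁ − x₂ − y₂) , not (sameFirst (x₁ , x₂) (y₁ , y₂))

  -- nothing = the fixed value used when x₁ = y₁
  χ₂ : Point → Point → Maybe (Bool × Bool)
  χ₂ x y = if sameFirst x y then nothing
           else (if lt x y then ord x y else ord y x)
    where
    ord : Point → Point → Maybe (Bool × Bool)
    ord (u₁ , _) (v₁ , _) = just (f u₁ v₁ , f v₁ u₁)

  χ : Point → Point → (Carrier × Bool) × Maybe (Bool × Bool)
  χ x y = χ₁ x y , χ₂ x y

  open CFLS ℓ using (φ)

  Colour : Set c
  Colour = (((ℕ × (List Bool × List Bool)) × List ℕ) × List Sign)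
           × ((Carrier × Bool) × Maybe (Bool × Bool))

  𝒞 : Point → Point → Colour
  𝒞 x y = φ (σ x) (σ y) , χ x y

IsSeparating : ∀ {c ℓ'} (R : CommutativeRing c ℓ') →
  (CommutativeRing.Carrier R → CommutativeRing.Carrier R → Bool) → Set c
IsSeparating R f = ∀ α β γ → ¬ (β ≡ α) → ¬ (γ ≡ α) → β +ᴿ γ ≡ α +ᴿ α → ¬ (f α β ≡ f α γ)
  where open CommutativeRing R renaming (_*_ to _*ᴿ_; _+_ to _+ᴿ_)

module Submission where

-- Write v(xy) = x₁y₁ − x₂ − y₂ for the value part of χ₁ and call x₁ the
-- column of x.  If b, e share a column, then so do d, e (χ₁ records this),
-- and v(be) = v(de) forces b = d.  Otherwise c, e lie in different columns
-- (else v(ac) = v(ae) forces c = e), so v(bc) = v(be) and v(ac) = v(ae)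
-- put a, b in one column A.  Then c, d share a column C, different from A
-- since ad, like be, joins two columns, and the value equations for
-- ab/cd, bc/ad and be/de force A + C = 2E, where E is the column of e.
-- Now f_E separates A and C, but the equal colours of be and de record
-- f_E(b₁) = f_E(d₁): the χ₂ part records f_E at the first coordinate of
-- the other endpoint in a slot fixed by the order, and the φ₁ part (first
-- differing block) fixes on which side of e the points b and d lie.

open import Defs
open import Data.Bool using (Bool; true; false; if_then_else_)
open import Data.Nat using (ℕ; _%_)
open import Data.Fin using (Fin)
open import Data.List using (List; []; _∷_)
open import Data.Product using (_×_; _,_; proj₁; proj₂; ∃)
open import Data.Empty using (⊥)
open import Function using (_∘_)
open import Function.Bundles using (_↔_)
open import Algebra.Bundles using (CommutativeRing)
open import Relation.Binary.PropositionalEquality using (_≡_)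
open import Relation.Nullary using (¬_; contradiction)

module BitStrings where

  open import Data.Nat using (zero; suc; _+_; _*_; _∸_; _^_; _≤_; _⊓_; _≤ᵇ_; s≤s; z≤n)
  open import Data.Nat.Properties
    using (≤-refl; ≤-trans; n≤1+n; 1+n≰n; m≤m+n; m≤m*n; m≤n⇒m⊓n≡m; m+n∸m≡n; suc-injective;
           +-identityʳ; +-suc; ≤ᵇ⇒≤)
  open import Data.Bool.Properties using (T-≡)
  open import Function using (Equivalence)
  open import Data.List using (_++_; take; drop; length)
  open import Data.List.Properties using (take++drop≡id; length-take; length-drop)
  open import Data.Sum using (_⊎_; inj₁; inj₂)
  open import Relation.Binary.PropositionalEquality
    using (refl; sym; trans; cong; cong₂; subst; module ≡-Reasoning)

  length-toBits : ∀ m n → length (toBits m n) ≡ m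
  length-toBits zero    n = refl
  length-toBits (suc m) n with 2 ^ m ≤ᵇ n
  ... | true  = cong suc (length-toBits m (n ∸ 2 ^ m))
  ... | false = cong suc (length-toBits m n)

  -- The search for the least k with t ≤ k² succeeds: it stops at a k with
  -- t ≤ k², or runs out of fuel at a k that is already large enough.
  searchSq-bound : ∀ t fuel k → t ≤ (k + fuel) * (k + fuel) → t ≤ searchSq t fuel k * searchSq t fuel k
  searchSq-bound t zero       k h = subst (λ n → t ≤ n * n) (+-identityʳ k) h
  searchSq-bound t (suc fuel) k h with t ≤ᵇ k * k in found
  ... | true  = ≤ᵇ⇒≤ t (k * k) (Equivalence.from T-≡ found)
  ... | false = searchSq-bound t fuel (suc k) (subst (λ n → t ≤ n * n) (+-suc k fuel) h)

  leastSqAbove-bound : ∀ t → t ≤ leastSqAbove t * leastSqAbove t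
  leastSqAbove-bound t = searchSq-bound t t 1 (≤-trans (n≤1+n t) (m≤m*n (suc t) (suc t)))

  eqBits-sound : ∀ u v → eqBits u v ≡ true → u ≡ v
  eqBits-sound []          []          _ = refl
  eqBits-sound (true ∷ u)  (true ∷ v)  h = cong (true ∷_) (eqBits-sound u v h)
  eqBits-sound (false ∷ u) (false ∷ v) h = cong (false ∷_) (eqBits-sound u v h)
  eqBits-sound (true ∷ u)  (false ∷ v) ()
  eqBits-sound (false ∷ u) (true ∷ v)  ()
  eqBits-sound []          (_ ∷ _)     ()
  eqBits-sound (_ ∷ _)     []          ()

  eqBits-refl : ∀ u → eqBits u u ≡ true
  eqBits-refl []          = refl
  eqBits-refl (true ∷ u)  = eqBits-refl u
  eqBits-refl (false ∷ u) = eqBits-refl u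

  eqBits-false : ∀ {u v} → eqBits u v ≡ false → ¬ u ≡ v
  eqBits-false {u} h refl = contradiction (trans (sym h) (eqBits-refl u)) λ ()

  ltBits-common-prefix : ∀ u s t → ltBits (u ++ s) (u ++ t) ≡ ltBits s t
  ltBits-common-prefix []          s t = refl
  ltBits-common-prefix (true ∷ u)  s t = ltBits-common-prefix u s t
  ltBits-common-prefix (false ∷ u) s t = ltBits-common-prefix u s t

  ltBits-differing-prefix : ∀ u v s t → length u ≡ length v → eqBits u v ≡ false →
    ltBits (u ++ s) (v ++ t) ≡ ltBits u v
  ltBits-differing-prefix []          []          s t _ ()
  ltBits-differing-prefix (true ∷ u)  (true ∷ v)  s t l h = ltBits-differing-prefix u v s t (suc-injective l) h
  ltBits-differing-prefix (false ∷ u) (false ∷ v) s t l h = ltBits-differing-prefix u v s t (suc-injective l) h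
  ltBits-differing-prefix (true ∷ u)  (false ∷ v) s t _ _ = refl
  ltBits-differing-prefix (false ∷ u) (true ∷ v)  s t _ _ = refl

  ltBlocks : List (List Bool) → List (List Bool) → Bool
  ltBlocks us       []       = false
  ltBlocks []       (w ∷ ws) = false
  ltBlocks (u ∷ us) (w ∷ ws) = if eqBits u w then ltBlocks us ws else ltBits u w

  length-take-prefix : ∀ l k (X : List Bool) → length X ≡ l + k → length (take l X) ≡ l
  length-take-prefix l k X h = trans (length-take l X) (trans (cong (l ⊓_) h) (m≤n⇒m⊓n≡m (m≤m+n l k)))

  length-drop-prefix : ∀ l k (X : List Bool) → length X ≡ l + k → length (drop l X) ≡ k
  length-drop-prefix l k X h = trans (length-drop l X) (trans (cong (_∸ l) h) (m+n∸m≡n l k))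

  ltBits-split : ∀ l X Z → ltBits X Z ≡ ltBits (take l X ++ drop l X) (take l Z ++ drop l Z)
  ltBits-split l X Z = sym (cong₂ ltBits (take++drop≡id l X) (take++drop≡id l Z))

  ltBits-chunks : ∀ l n X Z → length X ≡ n * l → length Z ≡ n * l →
    ltBits X Z ≡ ltBlocks (chunks l n X) (chunks l n Z)
  ltBits-chunks l zero    []      []      _  _  = refl
  ltBits-chunks l zero    (_ ∷ _) _       () _
  ltBits-chunks l zero    []      (_ ∷ _) _  ()
  ltBits-chunks l (suc n) X Z lx lz with eqBits (take l X) (take l Z) in same
  ... | true = begin
    ltBits X Z
      ≡⟨ ltBits-split l X Z ⟩
    ltBits (take l X ++ drop l X) (take l Z ++ drop l Z)
      ≡⟨ cong (λ u → ltBits (u ++ drop l X) (take l Z ++ drop l Z)) (eqBits-sound (take l X) (take l Z) same) ⟩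
    ltBits (take l Z ++ drop l X) (take l Z ++ drop l Z)
      ≡⟨ ltBits-common-prefix (take l Z) (drop l X) (drop l Z) ⟩
    ltBits (drop l X) (drop l Z)
      ≡⟨ ltBits-chunks l n (drop l X) (drop l Z) (length-drop-prefix l (n * l) X lx) (length-drop-prefix l (n * l) Z lz) ⟩
    ltBlocks (chunks l n (drop l X)) (chunks l n (drop l Z))
      ∎
    where open ≡-Reasoning
  ... | false = begin
    ltBits X Z
      ≡⟨ ltBits-split l X Z ⟩
    ltBits (take l X ++ drop l X) (take l Z ++ drop l Z)
      ≡⟨ ltBits-differing-prefix (take l X) (take l Z) (drop l X) (drop l Z) equal-lengths same ⟩
    ltBits (take l X) (take l Z)
      ∎
    where
    open ≡-Reasoning
    equal-lengths : length (take l X) ≡ length (take l Z)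
    equal-lengths = trans (length-take-prefix l (n * l) X lx) (sym (length-take-prefix l (n * l) Z lz))

  sortPair : List Bool → List Bool → List Bool × List Bool
  sortPair u w = if ltBits u w then (u , w) else (w , u)

  sortPair-determines-order : ∀ u v w → ¬ u ≡ w → sortPair u w ≡ sortPair v w → ltBits u w ≡ ltBits v w
  sortPair-determines-order u v w u≢w h with ltBits u w | ltBits v w
  ... | true  | true  = refl
  ... | false | false = refl
  ... | true  | false = contradiction (cong proj₁ h) u≢w
  ... | false | true  = contradiction (cong proj₂ h) u≢w

  firstBlock-index : ∀ i us ws → proj₁ (firstBlock i us ws) ≡ 0 ⊎ i ≤ proj₁ (firstBlock i us ws)
  firstBlock-index i []       ws       = inj₁ refl
  firstBlock-index i (u ∷ us) []       = inj₁ refl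
  firstBlock-index i (u ∷ us) (w ∷ ws) with eqBits u w
  ... | false = inj₂ ≤-refl
  ... | true with firstBlock-index (suc i) us ws
  ...   | inj₁ none  = inj₁ none
  ...   | inj₂ later = inj₂ (≤-trans (n≤1+n i) later)

  firstBlock-skips : ∀ i us ws p → 1 ≤ i → ¬ firstBlock (suc i) us ws ≡ (i , p)
  firstBlock-skips i us ws p 1≤i h with firstBlock-index (suc i) us ws
  ... | inj₁ none  = contradiction (subst (1 ≤_) (trans (sym (cong proj₁ h)) none) 1≤i) λ ()
  ... | inj₂ later = 1+n≰n (subst (suc i ≤_) (cong proj₁ h) later)

  firstBlock-none : ∀ i us ws → 1 ≤ i → proj₁ (firstBlock i us ws) ≡ 0 → ltBlocks us ws ≡ false
  firstBlock-none i us       []       _   _ = refl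
  firstBlock-none i []       (w ∷ ws) _   _ = refl
  firstBlock-none i (u ∷ us) (w ∷ ws) 1≤i h with eqBits u w
  ... | true  = firstBlock-none (suc i) us ws (s≤s z≤n) h
  ... | false = contradiction (subst (1 ≤_) h 1≤i) λ ()

  firstBlock-determines-order : ∀ i us vs ws → 1 ≤ i →
    firstBlock i us ws ≡ firstBlock i vs ws → ltBlocks us ws ≡ ltBlocks vs ws
  firstBlock-determines-order i us       vs       []       _   _ = refl
  firstBlock-determines-order i []       []       (w ∷ ws) _   _ = refl
  firstBlock-determines-order i []       (v ∷ vs) (w ∷ ws) 1≤i h =
    sym (firstBlock-none i (v ∷ vs) (w ∷ ws) 1≤i (sym (cong proj₁ h)))
  firstBlock-determines-order i (u ∷ us) []       (w ∷ ws) 1≤i h =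
    firstBlock-none i (u ∷ us) (w ∷ ws) 1≤i (cong proj₁ h)
  firstBlock-determines-order i (u ∷ us) (v ∷ vs) (w ∷ ws) 1≤i h
    with eqBits u w in u≉w | eqBits v w
  ... | true  | true  = firstBlock-determines-order (suc i) us vs ws (s≤s z≤n) h
  ... | false | false = sortPair-determines-order u v w (eqBits-false u≉w) (cong proj₂ h)
  ... | true  | false = contradiction h (firstBlock-skips i us ws (sortPair v w) 1≤i)
  ... | false | true  = contradiction (sym h) (firstBlock-skips i vs ws (sortPair u w) 1≤i)

module PlaneValue {c ℓ} (R : CommutativeRing c ℓ) where

  open CommutativeRing R

  value : Carrier × Carrier → Carrier × Carrier → Carrier
  value (x₁ , x₂) (y₁ , y₂) = x₁ * y₁ - x₂ - y₂

module FieldArithmetic {c ℓ} (R : CommutativeRing c ℓ) (isField : IsField R) where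

  open CommutativeRing R
  open PlaneValue R
  open import Algebra.Properties.Ring ring
    using (+-cancelˡ; +-cancelʳ; -‿injective; -‿+-comm; x∙y⁻¹≈ε⇒x≈y; [y-z]x≈yx-zx)
  open import Algebra.Solver.Ring.NaturalCoefficients.Default commutativeSemiring
    using (solve; _:=_; _:+_; _:*_)
  open import Relation.Binary.Reasoning.Setoid setoid

  *-cancelˡ-nonzero : ∀ x y z → ¬ x ≈ 0# → x * y ≈ x * z → y ≈ z
  *-cancelˡ-nonzero x y z x≉0 xy≈xz with proj₂ isField x x≉0
  ... | x⁻¹ , xx⁻¹≈1 = begin
    y                ≈⟨ *-identityˡ y ⟨
    1# * y           ≈⟨ *-congʳ xx⁻¹≈1 ⟨
    (x * x⁻¹) * y    ≈⟨ solve 3 (λ x x⁻¹ y → (x :* x⁻¹) :* y := x⁻¹ :* (x :* y)) refl x x⁻¹ y ⟩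
    x⁻¹ * (x * y)    ≈⟨ *-congˡ xy≈xz ⟩
    x⁻¹ * (x * z)    ≈⟨ solve 3 (λ x x⁻¹ z → x⁻¹ :* (x :* z) := (x :* x⁻¹) :* z) refl x x⁻¹ z ⟩
    (x * x⁻¹) * z    ≈⟨ *-congʳ xx⁻¹≈1 ⟩
    1# * z           ≈⟨ *-identityˡ z ⟩
    z                ∎

  regroup : ∀ x y z → (x - y) + (y + z) ≈ x + z
  regroup x y z = begin
    (x + - y) + (y + z) ≈⟨ solve 4 (λ x y z -y → (x :+ -y) :+ (y :+ z) := (x :+ z) :+ (y :+ -y))
                                   refl x y z (- y) ⟩
    (x + z) + (y - y)   ≈⟨ +-congˡ (-‿inverseʳ y) ⟩
    (x + z) + 0#        ≈⟨ +-identityʳ (x + z) ⟩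
    x + z               ∎

  difference⇒sum : ∀ {x y x′ y′} → x - y ≈ x′ - y′ → x + y′ ≈ x′ + y
  difference⇒sum {x} {y} {x′} {y′} h = begin
    x + y′               ≈⟨ regroup x y y′ ⟨
    (x - y) + (y + y′)   ≈⟨ +-cong h (+-comm y y′) ⟩
    (x′ - y′) + (y′ + y) ≈⟨ regroup x′ y′ y ⟩
    x′ + y               ∎

  sum⇒difference : ∀ {x y x′ y′} → x + y′ ≈ x′ + y → x - y ≈ x′ - y′
  sum⇒difference {x} {y} {x′} {y′} h = +-cancelʳ (y + y′) (x - y) (x′ - y′) (begin
    (x - y) + (y + y′)   ≈⟨ regroup x y y′ ⟩
    x + y′               ≈⟨ h ⟩
    x′ + y               ≈⟨ regroup x′ y′ y ⟨
    (x′ - y′) + (y′ + y) ≈⟨ +-congˡ (+-comm y′ y) ⟩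
    (x′ - y′) + (y + y′) ∎)

  value-balance : ∀ {k u w k′ u′ w′} → k - u - w ≈ k′ - u′ - w′ → k + (u′ + w′) ≈ k′ + (u + w)
  value-balance {k} {u} {w} {k′} {u′} {w′} h = difference⇒sum (begin
    k - (u + w)      ≈⟨ combine k u w ⟨
    k - u - w        ≈⟨ h ⟩
    k′ - u′ - w′     ≈⟨ combine k′ u′ w′ ⟩
    k′ - (u′ + w′)   ∎)
    where
    combine : ∀ k u w → k - u - w ≈ k - (u + w)
    combine k u w = trans (+-assoc k (- u) (- w)) (+-congˡ (-‿+-comm u w))

  -- Cross-multiplication: (x − y)(u − v) = 0 with x ≠ y forces u = v.
  cross-cancel : ∀ x y u v → x * u + y * v ≈ x * v + y * u → ¬ x ≈ y → u ≈ v
  cross-cancel x y u v h x≉y =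
    *-cancelˡ-nonzero (x - y) u v (λ x-y≈0 → x≉y (x∙y⁻¹≈ε⇒x≈y x y x-y≈0)) (begin
    (x - y) * u    ≈⟨ [y-z]x≈yx-zx u x y ⟩
    x * u - y * u  ≈⟨ sum⇒difference h ⟩
    x * v - y * v  ≈⟨ [y-z]x≈yx-zx v x y ⟨
    (x - y) * v    ∎)

  value-cancel-middle : ∀ k u v w → k - u - w ≈ k - v - w → u ≈ v
  value-cancel-middle k u v w h =
    -‿injective (+-cancelˡ k (- u) (- v) (+-cancelʳ (- w) (k - u) (k - v) h))

  value-cancel-last : ∀ k w u v → k - w - u ≈ k - w - v → u ≈ v
  value-cancel-last k w u v h = -‿injective (+-cancelˡ (k - w) (- u) (- v) h)

  -- Two points b, a that see the points c, e (in different columns) with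
  -- equal values lie in the same column: x ↦ value x c − value x e is
  -- x₁(c₁ − e₁) − (c₂ − e₂), injective in x₁ when c₁ ≠ e₁.
  equal-values⇒same-column : ∀ a b c e → value b c ≈ value b e → value a c ≈ value a e →
    ¬ proj₁ c ≈ proj₁ e → proj₁ b ≈ proj₁ a
  equal-values⇒same-column (a₁ , a₂) (b₁ , b₂) (c₁ , c₂) (e₁ , e₂) hb ha c≉e =
    cross-cancel c₁ e₁ b₁ a₁ (+-cancelʳ K _ _ (begin
      (c₁ * b₁ + e₁ * a₁) + K
        ≈⟨ solve 8 (λ a₁ a₂ b₁ b₂ c₁ c₂ e₁ e₂ →
             (c₁ :* b₁ :+ e₁ :* a₁) :+ ((b₂ :+ e₂) :+ (a₂ :+ c₂)) :=
             (b₁ :* c₁ :+ (b₂ :+ e₂)) :+ (a₁ :* e₁ :+ (a₂ :+ c₂))) refl a₁ a₂ b₁ b₂ c₁ c₂ e₁ e₂ ⟩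
      (b₁ * c₁ + (b₂ + e₂)) + (a₁ * e₁ + (a₂ + c₂))
        ≈⟨ +-cong (value-balance hb) (sym (value-balance ha)) ⟩
      (b₁ * e₁ + (b₂ + c₂)) + (a₁ * c₁ + (a₂ + e₂))
        ≈⟨ solve 8 (λ a₁ a₂ b₁ b₂ c₁ c₂ e₁ e₂ →
             (b₁ :* e₁ :+ (b₂ :+ c₂)) :+ (a₁ :* c₁ :+ (a₂ :+ e₂)) :=
             (c₁ :* a₁ :+ e₁ :* b₁) :+ ((b₂ :+ e₂) :+ (a₂ :+ c₂))) refl a₁ a₂ b₁ b₂ c₁ c₂ e₁ e₂ ⟩
      (c₁ * a₁ + e₁ * b₁) + K
        ∎)) c≉e
    where K = (b₂ + e₂) + (a₂ + c₂)

  -- Let a, b lie in column A and c, d in a different column C.  If the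
  -- edges be, de, the edges bc, ad and the edges ab, cd have equal values,
  -- then the column E of e is the midpoint of A and C: adding the balanced
  -- equations for ab/cd and bc/ad and subtracting twice that for be/de
  -- gives A² + 2CE = C² + 2AE, i.e. (A − C)(A + C) = (A − C)(E + E).
  column-midpoint : ∀ A C E a₂ b₂ c₂ d₂ e₂ →
    value (A , b₂) (E , e₂) ≈ value (C , d₂) (E , e₂) →
    value (A , b₂) (C , c₂) ≈ value (A , a₂) (C , d₂) →
    value (A , a₂) (A , b₂) ≈ value (C , c₂) (C , d₂) →
    ¬ A ≈ C → A + C ≈ E + E
  column-midpoint A C E a₂ b₂ c₂ d₂ e₂ be~de bc~ad ab~cd A≉C =
    cross-cancel A C (A + C) (E + E) (+-cancelʳ K _ _ (begin
      (A * (A + C) + C * (E + E)) + K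
        ≈⟨ solve 8 (λ A C E a₂ b₂ c₂ d₂ e₂ →
             (A :* (A :+ C) :+ C :* (E :+ E)) :+ (((c₂ :+ d₂) :+ (a₂ :+ d₂)) :+ ((b₂ :+ e₂) :+ (b₂ :+ e₂))) :=
             ((A :* A :+ (c₂ :+ d₂)) :+ (A :* C :+ (a₂ :+ d₂))) :+
             ((C :* E :+ (b₂ :+ e₂)) :+ (C :* E :+ (b₂ :+ e₂))))
           refl A C E a₂ b₂ c₂ d₂ e₂ ⟩
      ((A * A + (c₂ + d₂)) + (A * C + (a₂ + d₂))) + ((C * E + (b₂ + e₂)) + (C * E + (b₂ + e₂)))
        ≈⟨ +-cong (+-cong (value-balance ab~cd) (value-balance bc~ad))
                  (sym (+-cong (value-balance be~de) (value-balance be~de))) ⟩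
      ((C * C + (a₂ + b₂)) + (A * C + (b₂ + c₂))) + ((A * E + (d₂ + e₂)) + (A * E + (d₂ + e₂)))
        ≈⟨ solve 8 (λ A C E a₂ b₂ c₂ d₂ e₂ →
             ((C :* C :+ (a₂ :+ b₂)) :+ (A :* C :+ (b₂ :+ c₂))) :+
             ((A :* E :+ (d₂ :+ e₂)) :+ (A :* E :+ (d₂ :+ e₂))) :=
             (A :* (E :+ E) :+ C :* (A :+ C)) :+ (((c₂ :+ d₂) :+ (a₂ :+ d₂)) :+ ((b₂ :+ e₂) :+ (b₂ :+ e₂))))
           refl A C E a₂ b₂ c₂ d₂ e₂ ⟩
      (A * (E + E) + C * (A + C)) + K
        ∎)) A≉C
    where K = ((c₂ + d₂) + (a₂ + d₂)) + ((b₂ + e₂) + (b₂ + e₂))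

module ColourFacts {c ℓ'} (R : CommutativeRing c ℓ') (q : ℕ)
                   (enum : CommutativeRing.Carrier R ↔ Fin q)
                   (f : CommutativeRing.Carrier R → CommutativeRing.Carrier R → Bool) where

  open import Data.Nat using (_+_; _*_; _∸_; s≤s; z≤n)
  open import Data.Nat.Properties using (+-assoc; +-identityʳ; m+[n∸m]≡n; ≡ᵇ⇒≡; ≡⇒≡ᵇ)
  open import Data.Bool.Properties using (not-injective; T-≡)
  open import Data.Fin.Properties using (toℕ-injective)
  open import Data.List using (_++_; length; replicate)
  open import Data.List.Properties using (length-++; length-replicate)
  open import Data.Maybe.Properties using (just-injective)
  open import Function using (Equivalence; Injection)
  open import Function.Properties.Inverse using (↔⇒↣)
  open import Relation.Binary.PropositionalEquality using (refl; sym; trans; cong; cong₂; module ≡-Reasoning)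
  open Combined R q enum f
  open CFLS ℓ using (blocks)
  open PlaneValue R
  open BitStrings

  length-σ : ∀ x → length (σ x) ≡ ℓ * ℓ
  length-σ (x₁ , x₂) = begin
    length (bin x₁ ++ bin x₂ ++ padding)
      ≡⟨ length-++ (bin x₁) ⟩
    length (bin x₁) + length (bin x₂ ++ padding)
      ≡⟨ cong (length (bin x₁) +_) (length-++ (bin x₂)) ⟩
    length (bin x₁) + (length (bin x₂) + length padding)
      ≡⟨ cong₂ (λ u v → u + (v + length padding)) (length-toBits m (rank x₁)) (length-toBits m (rank x₂)) ⟩
    m + (m + length padding)
      ≡⟨ cong (λ n → m + (m + n)) (length-replicate (ℓ * ℓ ∸ 2 * m)) ⟩
    m + (m + (ℓ * ℓ ∸ 2 * m))
      ≡⟨ +-assoc m m (ℓ * ℓ ∸ 2 * m) ⟨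
    m + m + (ℓ * ℓ ∸ 2 * m)
      ≡⟨ cong (λ n → m + n + (ℓ * ℓ ∸ 2 * m)) (+-identityʳ m) ⟨
    2 * m + (ℓ * ℓ ∸ 2 * m)
      ≡⟨ m+[n∸m]≡n (leastSqAbove-bound (2 * m)) ⟩
    ℓ * ℓ
      ∎
    where
    open ≡-Reasoning
    padding = replicate (ℓ * ℓ ∸ 2 * m) false

  rank-injective : ∀ {α β} → rank α ≡ rank β → α ≡ β
  rank-injective = Injection.injective (↔⇒↣ enum) ∘ toℕ-injective

  sameFirst-sound : ∀ x y → sameFirst x y ≡ true → proj₁ x ≡ proj₁ y
  sameFirst-sound (x₁ , _) (y₁ , _) h = rank-injective (≡ᵇ⇒≡ (rank x₁) (rank y₁) (Equivalence.from T-≡ h))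

  sameFirst-complete : ∀ x y → proj₁ x ≡ proj₁ y → sameFirst x y ≡ true
  sameFirst-complete (x₁ , _) (.x₁ , _) refl = Equivalence.to T-≡ (≡⇒≡ᵇ (rank x₁) (rank x₁) refl)

  sameFirst-false : ∀ x y → sameFirst x y ≡ false → ¬ proj₁ x ≡ proj₁ y
  sameFirst-false x y h p = contradiction (trans (sym h) (sameFirst-complete x y p)) λ ()

  value-of : ∀ {x y z w} → 𝒞 x y ≡ 𝒞 z w → value x y ≡ value z w
  value-of = cong (proj₁ ∘ proj₁ ∘ proj₂)

  columns-of : ∀ {x y z w} → 𝒞 x y ≡ 𝒞 z w → sameFirst x y ≡ sameFirst z w
  columns-of = not-injective ∘ cong (proj₂ ∘ proj₁ ∘ proj₂)

  -- ... and, for a common endpoint z, the same order relative to z: the φ₁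
  -- part records the first differing block of σ x and σ z together with
  -- the sorted pair of those blocks.
  order-of : ∀ x y z → 𝒞 x z ≡ 𝒞 y z → lt x z ≡ lt y z
  order-of x y z h = begin
    lt x z                                  ≡⟨ ltBits-chunks ℓ ℓ (σ x) (σ z) (length-σ x) (length-σ z) ⟩
    ltBlocks (blocks (σ x)) (blocks (σ z))  ≡⟨ firstBlock-determines-order 1 (blocks (σ x)) (blocks (σ y)) (blocks (σ z))
                                                 (s≤s z≤n) (cong (proj₁ ∘ proj₁ ∘ proj₁) h) ⟩
    ltBlocks (blocks (σ y)) (blocks (σ z))  ≡⟨ ltBits-chunks ℓ ℓ (σ y) (σ z) (length-σ y) (length-σ z) ⟨
    lt y z                                  ∎
    where open ≡-Reasoning

  -- For edges xz, yz leaving the column of z, χ₂ records f_{z₁} at the first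
  -- coordinate of x, resp. y, in the same slot, since x and y lie on the
  -- same side of z; so f_{z₁} takes the same value at x₁ and y₁.
  side-of : ∀ x y z → sameFirst x z ≡ false → sameFirst y z ≡ false → 𝒞 x z ≡ 𝒞 y z →
    f (proj₁ z) (proj₁ x) ≡ f (proj₁ z) (proj₁ y)
  side-of x y z x|z y|z h = recorded (order-of x y z h) (cong (proj₂ ∘ proj₂) h)
    where
    recorded : lt x z ≡ lt y z → χ₂ x z ≡ χ₂ y z → f (proj₁ z) (proj₁ x) ≡ f (proj₁ z) (proj₁ y)
    recorded same-side same rewrite x|z | y|z | same-side with lt y z
    ... | true  = cong proj₂ (just-injective same)
    ... | false = cong proj₁ (just-injective same)

module ForbiddenConfiguration {c ℓ'} (R : CommutativeRing c ℓ') (q : ℕ)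
    (enum : CommutativeRing.Carrier R ↔ Fin q)
    (f : CommutativeRing.Carrier R → CommutativeRing.Carrier R → Bool)
    (isField : IsField R)
    (≈⇒≡ : ∀ {x y} → CommutativeRing._≈_ R x y → x ≡ y)
    (separating : IsSeparating R f) where

  open CommutativeRing R using (_≈_; _+_; _*_; reflexive)
  open Combined R q enum f using (𝒞; sameFirst)
  open PlaneValue R
  open FieldArithmetic R isField
  open ColourFacts R q enum f
  open import Relation.Binary.PropositionalEquality using (refl; sym; trans; cong; subst₂)

  equal-values : ∀ {x y z w} → 𝒞 x y ≡ 𝒞 z w → value x y ≈ value z w
  equal-values = reflexive ∘ value-of

  column-determinedˡ : ∀ x y z → proj₁ x ≡ proj₁ y → value x z ≈ value y z → x ≡ y
  column-determinedˡ (x₁ , x₂) (.x₁ , y₂) (z₁ , z₂) refl h =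
    cong (x₁ ,_) (≈⇒≡ (value-cancel-middle (x₁ * z₁) x₂ y₂ z₂ h))

  column-determinedʳ : ∀ x y z → proj₁ y ≡ proj₁ z → value x y ≈ value x z → y ≡ z
  column-determinedʳ (x₁ , x₂) (y₁ , y₂) (.y₁ , z₂) refl h =
    cong (y₁ ,_) (≈⇒≡ (value-cancel-last (x₁ * y₁) x₂ y₂ z₂ h))

  midpoint : ∀ a b c d e → proj₁ b ≡ proj₁ a → proj₁ d ≡ proj₁ c →
    value b e ≈ value d e → value b c ≈ value a d → value a b ≈ value c d →
    ¬ proj₁ a ≡ proj₁ c → proj₁ a + proj₁ c ≡ proj₁ e + proj₁ e
  midpoint (A , a₂) (.A , b₂) (C , c₂) (.C , d₂) (E , e₂) refl refl be~de bc~ad ab~cd A≢C =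
    ≈⇒≡ (column-midpoint A C E a₂ b₂ c₂ d₂ e₂ be~de bc~ad ab~cd (A≢C ∘ ≈⇒≡))

  -- If b and e share a column, so do d and e, and then v(be) = v(de) forces b = d.
  impossible-same-column : ∀ b d e → ¬ b ≡ d → 𝒞 b e ≡ 𝒞 d e → sameFirst b e ≡ true → ⊥
  impossible-same-column b d e b≢d be~de b|e =
    b≢d (column-determinedˡ b d e (trans (sameFirst-sound b e b|e) (sym (sameFirst-sound d e d|e)))
                                  (equal-values be~de))
    where
    d|e : sameFirst d e ≡ true
    d|e = trans (sym (columns-of be~de)) b|e

  -- Otherwise a, b share a column and so do c, d; then the column of e is
  -- their midpoint, so f at e separates a₁ and c₁, while the colours of be
  -- and de say that f at e agrees on b₁ = a₁ and d₁ = c₁.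
  impossible-different-columns : ∀ a b c d e → ¬ c ≡ e →
    𝒞 a b ≡ 𝒞 c d → 𝒞 b c ≡ 𝒞 a d → 𝒞 a d ≡ 𝒞 b e → 𝒞 b e ≡ 𝒞 d e → 𝒞 a c ≡ 𝒞 a e →
    sameFirst b e ≡ false → ⊥
  impossible-different-columns a b c d e c≢e ab~cd bc~ad ad~be be~de ac~ae b|e =
    separating (proj₁ e) (proj₁ a) (proj₁ c) a₁≢e₁ c₁≢e₁ a+c≡2e
      (subst₂ (λ u v → f (proj₁ e) u ≡ f (proj₁ e) v) b₁≡a₁ d₁≡c₁ (side-of b d e b|e d|e be~de))
    where
    d|e : sameFirst d e ≡ false
    d|e = trans (sym (columns-of be~de)) b|e
    c₁≢e₁ : ¬ proj₁ c ≡ proj₁ e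
    c₁≢e₁ c₁≡e₁ = c≢e (column-determinedʳ a c e c₁≡e₁ (equal-values ac~ae))
    b₁≡a₁ : proj₁ b ≡ proj₁ a
    b₁≡a₁ = ≈⇒≡ (equal-values⇒same-column a b c e (equal-values (trans bc~ad ad~be)) (equal-values ac~ae)
                                                  (c₁≢e₁ ∘ ≈⇒≡))
    d₁≡c₁ : proj₁ d ≡ proj₁ c
    d₁≡c₁ = sym (sameFirst-sound c d (trans (sym (columns-of ab~cd)) (sameFirst-complete a b (sym b₁≡a₁))))
    a₁≢e₁ : ¬ proj₁ a ≡ proj₁ e
    a₁≢e₁ a₁≡e₁ = sameFirst-false b e b|e (trans b₁≡a₁ a₁≡e₁)
    a₁≢c₁ : ¬ proj₁ a ≡ proj₁ c
    a₁≢c₁ a₁≡c₁ = sameFirst-false a d (trans (columns-of ad~be) b|e) (trans a₁≡c₁ (sym d₁≡c₁))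
    a+c≡2e : proj₁ a + proj₁ c ≡ proj₁ e + proj₁ e
    a+c≡2e = midpoint a b c d e b₁≡a₁ d₁≡c₁ (equal-values be~de) (equal-values bc~ad) (equal-values ab~cd) a₁≢c₁

  -- The configuration is impossible; of the distinctness conditions only
  -- b ≠ d and c ≠ e are needed.
  impossible : ∀ a b c d e → ¬ b ≡ d → ¬ c ≡ e →
    𝒞 a b ≡ 𝒞 c d → 𝒞 b c ≡ 𝒞 a d → 𝒞 a d ≡ 𝒞 b e → 𝒞 b e ≡ 𝒞 d e → 𝒞 a c ≡ 𝒞 a e → ⊥
  impossible a b c d e b≢d c≢e ab~cd bc~ad ad~be be~de ac~ae = by-columns (sameFirst b e) refl
    where
    by-columns : ∀ s → sameFirst b e ≡ s → ⊥
    by-columns true  = impossible-same-column b d e b≢d be~de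
    by-columns false = impossible-different-columns a b c d e c≢e ab~cd bc~ad ad~be be~de ac~ae

lemma17 : ∀ {c ℓ'} (R : CommutativeRing c ℓ') (q : ℕ) →
    IsPrimePower q → q % 2 ≡ 1 →
    IsField R →
    (∀ {x y} → CommutativeRing._≈_ R x y → x ≡ y) →
    (e : CommutativeRing.Carrier R ↔ Fin q) →
    (f : CommutativeRing.Carrier R → CommutativeRing.Carrier R → Bool) →
    IsSeparating R f →
    let open Combined R q e f in
    ¬ (∃ λ (a : Point) → ∃ λ (b : Point) → ∃ λ (c : Point) → ∃ λ (d : Point) → ∃ λ (e′ : Point) →
         (¬ a ≡ b × ¬ a ≡ c × ¬ a ≡ d × ¬ a ≡ e′ × ¬ b ≡ c × ¬ b ≡ d × ¬ b ≡ e′ ×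
          ¬ c ≡ d × ¬ c ≡ e′ × ¬ d ≡ e′) ×
         𝒞 a b ≡ 𝒞 c d ×
         (𝒞 b c ≡ 𝒞 a d × 𝒞 a d ≡ 𝒞 b e′ × 𝒞 b e′ ≡ 𝒞 d e′) ×
         𝒞 a c ≡ 𝒞 a e′)
lemma17 R q _ _ isField ≈⇒≡ e f separating
  (a , b , c , d , e′ , (_ , _ , _ , _ , _ , b≢d , _ , _ , c≢e′ , _) , ab~cd , (bc~ad , ad~be′ , be′~de′) , ac~ae′) =
  ForbiddenConfiguration.impossible R q e f isField ≈⇒≡ separating
    a b c d e′ b≢d c≢e′ ab~cd bc~ad ad~be′ be′~de′ ac~ae′
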